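{- Consider the game with fixed formula set $\Gamma$ and let $\mathcal{C}=(\mathcal{O},\mathcal{P},\Delta)$ be a position of it. Suppose there is a Kripke model $M$, over the language $\Omega$ extended by all elements of $\Delta$ that are not constants of $\Omega$, based on a frame in the class $N$, and a world $\omega$ of $M$ such that every formula of $\mathcal{O}$ is true at $\omega$ and some formula of $\mathcal{P}$ is not true at $\omega$. Then Opponent has a winning strategy from the position $\mathcal{C}$.
   Context: Language: $\Omega$ is a first-order intuitionistic language with predicate symbols and constants but no function symbols; connectives $\to,\wedge,\vee,\bot$ and quantifiers $\forall,\exists$; $\neg A$ abbreviates $A\to\bot$. Kripke frames are partially ordered sets of worlds together with an individual domain $\Delta_w$ at each world $w$, monotone along the order; a Kripke model adds an interpretation of constants and a monotone interpretation of atomic formulas, with the usual intuitionistic forcing clauses. $N$ is the class of Noetherian Kripke frames: frames with no infinite strictly increasing sequence of worlds. The game. For a set of formulas $\Gamma$ and a set $\Delta$ of objects, $\mathcal{F}(\Gamma,\Delta)$ is the set of all formulas $P[c_1,\dots,c_n]$ where $P[x_1,\dots,x_n]$ is a subformula of some formula of $\Gamma$ whose free variables are among $x_1,\dots,x_n$ and $c_i\in\Delta$. A position is a triple $\mathcal{C}=(\mathcal{O},\mathcal{P},\Delta)$ with $\mathcal{O},\mathcal{P}\subseteq\mathcal{F}(\Gamma,\Delta)$, where $\Gamma$ is fixed at the start of the game as $\mathcal{O}_0\cup\{\varphi\}$ for the starting position $(\mathcal{O}_0,\{\varphi\},\Delta_0)$ ($\mathcal{O}_0$ a set of closed formulas,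 $\varphi$ closed), with $\Delta_0$ the set of constants occurring in $\Gamma$. Proponent moves by adding formulas of $\mathcal{F}(\Gamma,\Delta)$ to $\mathcal{P}$. Opponent moves by first extending $\Delta$ to some $\Delta'\supseteq\Delta$ (possibly $\Delta'=\Delta$; new elements may be arbitrary new objects) and then adding formulas of $\mathcal{F}(\Gamma,\Delta')$ to $\mathcal{O}$. Truth in a position, for formulas of $\mathcal{F}(\Gamma,\Delta)$: $\mathcal{C}\nVdash\bot$; for atomic $A[c_1,\dots,c_n]$, $\mathcal{C}\Vdash A[c_1,\dots,c_n]$ iff $A[c_1,\dots,c_n]\in\mathcal{O}$; for $\star\in\{\to,\wedge,\vee\}$, $\mathcal{C}\Vdash\psi\star\chi$ iff $\psi\star\chi\in\mathcal{O}\cup\mathcal{P}$ and $(\mathcal{C}\Vdash\psi)\star(\mathcal{C}\Vdash\chi)$ holds with $\star$ read classically; for $q\in\{\forall,\exists\}$, $\mathcal{C}\Vdash qxP[x]$ iff $qxP[x]\in\mathcal{O}\cup\mathcal{P}$ and for $q$ (read classically) $\alpha\in\Delta$, $\mathcal{C}\Vdash P[\alpha]$. A formula of $\mathcal{P}$ (resp. $\mathcal{O}$) false in the current position is a mistake of Proponent (resp. Opponent). If Opponent has no mistakes but Proponent has a mistake, Proponent must move; otherwise Opponent must move. If after a player's move that same player must move again, that player loses and the game ends. If the game continues infinitely, Proponent wins. -}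

module Defs where

open import Level using (Level; 0ℓ)
open import Data.Nat using (ℕ; _≟_)
open import Data.Maybe using (Maybe; just; nothing; maybe)
open import Data.Vec using (Vec)
import Data.Vec as Vec
open import Data.Vec.Relation.Binary.Pointwise.Inductive using (Pointwise)
open import Data.Vec.Relation.Unary.All using (All)
import Data.Vec.Relation.Unary.Any
open import Data.Product using (Σ; _×_; _,_)
open import Data.Sum using (_⊎_; inj₁; inj₂)
import Data.Sum as Sum
open import Data.Empty using (⊥)
open import Data.Unit using (⊤)
open import Relation.Nullary using (¬_; does)
open import Relation.Binary.PropositionalEquality using (_≡_; _≢_)
open import Relation.Binary.Structures using (IsPartialOrder)
open import Data.Bool using (if_then_else_)

record Signature : Set₁ where
  field
    Pred  : Set
    ar    : Pred → ℕ
    Const : Set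

open Signature public

-- Terms and formulas.  Variables are named by natural numbers; the
-- closed "parameter" terms range over a type T (constants of the
-- language, possibly extended by new names).

data Tm (T : Set) : Set where
  var : ℕ → Tm T
  obj : T → Tm T

module _ (S : Signature) where

  data Fm (T : Set) : Set where
    atom : (p : Pred S) → Vec (Tm T) (ar S p) → Fm T
    ⊥'   : Fm T
    _⇒_  : Fm T → Fm T → Fm T
    _∧'_ : Fm T → Fm T → Fm T
    _∨'_ : Fm T → Fm T → Fm T
    ∀'   : ℕ → Fm T → Fm T
    ∃'   : ℕ → Fm T → Fm T

_[_↦_] : {X : Set} → (ℕ → Maybe X) → ℕ → X → (ℕ → Maybe X)
(ρ [ x ↦ a ]) y = if does (y ≟ x) then just a else ρ y

_∖_ : {X : Set} → (ℕ → Maybe X) → ℕ → (ℕ → Maybe X)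
(ρ ∖ x) y = if does (y ≟ x) then nothing else ρ y

∅ : {X : Set} → ℕ → Maybe X
∅ _ = nothing


module _ {S : Signature} where

  data FreeTm (x : ℕ) {T : Set} : Tm T → Set where
    here : FreeTm x (var x)

  data FreeIn (x : ℕ) {T : Set} : Fm S T → Set where
    atom : ∀ {p ts} → Data.Vec.Relation.Unary.Any.Any (FreeTm x) ts → FreeIn x (atom p ts)
    ⇒ˡ : ∀ {A B} → FreeIn x A → FreeIn x (A ⇒ B)
    ⇒ʳ : ∀ {A B} → FreeIn x B → FreeIn x (A ⇒ B)
    ∧ˡ : ∀ {A B} → FreeIn x A → FreeIn x (A ∧' B)
    ∧ʳ : ∀ {A B} → FreeIn x B → FreeIn x (A ∧' B)
    ∨ˡ : ∀ {A B} → FreeIn x A → FreeIn x (A ∨' B)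
    ∨ʳ : ∀ {A B} → FreeIn x B → FreeIn x (A ∨' B)
    ∀' : ∀ {y A} → x ≢ y → FreeIn x A → FreeIn x (∀' y A)
    ∃' : ∀ {y A} → x ≢ y → FreeIn x A → FreeIn x (∃' y A)

  Closed : {T : Set} → Fm S T → Set
  Closed φ = ∀ x → ¬ FreeIn x φ

  data _≼_ {T : Set} : Fm S T → Fm S T → Set where
    refl : ∀ {A} → A ≼ A
    ⇒ˡ : ∀ {C A B} → C ≼ A → C ≼ (A ⇒ B)
    ⇒ʳ : ∀ {C A B} → C ≼ B → C ≼ (A ⇒ B)
    ∧ˡ : ∀ {C A B} → C ≼ A → C ≼ (A ∧' B)
    ∧ʳ : ∀ {C A B} → C ≼ B → C ≼ (A ∧' B)
    ∨ˡ : ∀ {C A B} → C ≼ A → C ≼ (A ∨' B)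
    ∨ʳ : ∀ {C A B} → C ≼ B → C ≼ (A ∨' B)
    ∀' : ∀ {C y A} → C ≼ A → C ≼ (∀' y A)
    ∃' : ∀ {C y A} → C ≼ A → C ≼ (∃' y A)

  mapTm : {A B : Set} → (A → B) → Tm A → Tm B
  mapTm f (var x) = var x
  mapTm f (obj a) = obj (f a)

  mapFm : {A B : Set} → (A → B) → Fm S A → Fm S B
  mapFm f (atom p ts) = atom p (Vec.map (mapTm f) ts)
  mapFm f ⊥' = ⊥'
  mapFm f (A ⇒ B) = mapFm f A ⇒ mapFm f B
  mapFm f (A ∧' B) = mapFm f A ∧' mapFm f B
  mapFm f (A ∨' B) = mapFm f A ∨' mapFm f B
  mapFm f (∀' x A) = ∀' x (mapFm f A)
  mapFm f (∃' x A) = ∃' x (mapFm f A)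

  subTm : {T : Set} → (ℕ → Maybe T) → Tm T → Tm T
  subTm ρ (var y) = maybe obj (var y) (ρ y)
  subTm ρ (obj a) = obj a

  sub : {T : Set} → (ℕ → Maybe T) → Fm S T → Fm S T
  sub ρ (atom p ts) = atom p (Vec.map (subTm ρ) ts)
  sub ρ ⊥' = ⊥'
  sub ρ (A ⇒ B) = sub ρ A ⇒ sub ρ B
  sub ρ (A ∧' B) = sub ρ A ∧' sub ρ B
  sub ρ (A ∨' B) = sub ρ A ∨' sub ρ B
  sub ρ (∀' x A) = ∀' x (sub (ρ ∖ x) A)
  sub ρ (∃' x A) = ∃' x (sub (ρ ∖ x) A)

-- The set Δ of objects of a position consists of the constants of Ω
-- that belong to Δ (predicate ΔC) together with the remaining objects,
-- which are the elements of the type New.  Formulas of F(Γ,Δ) have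
-- parameters in Const ⊎ New.

module _ (S : Signature) where

  record Pos : Set₁ where
    field
      New : Set
      ΔC  : Const S → Set
      O   : Fm S (Const S ⊎ New) → Set
      P   : Fm S (Const S ⊎ New) → Set

  open Pos public

  InΔ : (New : Set) → (Const S → Set) → Const S ⊎ New → Set
  InΔ New ΔC (inj₁ k) = ΔC k
  InΔ New ΔC (inj₂ _) = ⊤

  -- φ ∈ F(Γ,Δ): φ = P[c₁,…,cₙ] with P[x₁,…,xₙ] a subformula of a formula of Γ,
  -- all free variables of P among the xᵢ, and cᵢ ∈ Δ.
  InF : (Γ : Fm S (Const S) → Set) (New : Set) (ΔC : Const S → Set)
      → Fm S (Const S ⊎ New) → Set
  InF Γ New ΔC φ =
    Σ (Fm S (Const S)) λ γ → Γ γ ×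
    Σ (Fm S (Const S)) λ ψ → ψ ≼ γ ×
    Σ (ℕ → Maybe (Const S ⊎ New)) λ ρ →
      (∀ x → FreeIn x ψ → Σ (Const S ⊎ New) λ c → (ρ x ≡ just c) × InΔ New ΔC c) ×
      (φ ≡ sub ρ (mapFm inj₁ ψ))

  Γof : (Fm S (Const S) → Set) → Fm S (Const S) → Fm S (Const S) → Set
  Γof O₀ φ ψ = O₀ ψ ⊎ ψ ≡ φ

  IsPosition : (Γ : Fm S (Const S) → Set) → Pos → Set
  IsPosition Γ C = (∀ φ → O C φ → InF Γ (New C) (ΔC C) φ)
                 × (∀ φ → P C φ → InF Γ (New C) (ΔC C) φ)

  module _ (C : Pos) where
    private T = Const S ⊎ New C

    InOP : Fm S T → Set
    InOP φ = O C φ ⊎ P C φ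

    Tr : (ℕ → Maybe T) → Fm S T → Set
    Tr ρ (atom p ts) = O C (sub ρ (atom p ts))
    Tr ρ ⊥' = ⊥
    Tr ρ (A ⇒ B) = InOP (sub ρ (A ⇒ B)) × (Tr ρ A → Tr ρ B)
    Tr ρ (A ∧' B) = InOP (sub ρ (A ∧' B)) × (Tr ρ A × Tr ρ B)
    Tr ρ (A ∨' B) = InOP (sub ρ (A ∨' B)) × (Tr ρ A ⊎ Tr ρ B)
    Tr ρ (∀' x A) = InOP (sub ρ (∀' x A)) × ((c : T) → InΔ (New C) (ΔC C) c → Tr (ρ [ x ↦ c ]) A)
    Tr ρ (∃' x A) = InOP (sub ρ (∃' x A)) × Σ T (λ c → InΔ (New C) (ΔC C) c × Tr (ρ [ x ↦ c ]) A)

    Holds : Fm S T → Set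
    Holds φ = Tr (∅ {X = T}) φ

    OppMistake : Set
    OppMistake = Σ (Fm S T) λ φ → O C φ × ¬ Holds φ

    PropMistake : Set
    PropMistake = Σ (Fm S T) λ φ → P C φ × ¬ Holds φ

    PropMustMove : Set
    PropMustMove = ¬ OppMistake × PropMistake

    OppMustMove : Set
    OppMustMove = ¬ PropMustMove

  module _ (Γ : Fm S (Const S) → Set) where

    record PMove (C : Pos) : Set₁ where
      field
        A   : Fm S (Const S ⊎ New C) → Set
        A⊆F : ∀ φ → A φ → InF Γ (New C) (ΔC C) φ

    pmove : (C : Pos) → PMove C → Pos
    pmove C m = record C { P = λ φ → P C φ ⊎ PMove.A m φ }

    record OMove (C : Pos) : Set₁ where
      field
        X    : Set
        ΔC'  : Const S → Set
        ext  : ∀ k → ΔC C k → ΔC' k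
        A    : Fm S (Const S ⊎ (New C ⊎ X)) → Set
        A⊆F  : ∀ φ → A φ → InF Γ (New C ⊎ X) ΔC' φ

    Image : {N X : Set} → (Fm S (Const S ⊎ N) → Set) → Fm S (Const S ⊎ (N ⊎ X)) → Set
    Image {N} {X} Q φ = Σ (Fm S (Const S ⊎ N)) λ ψ → Q ψ × (mapFm (Sum.map₂ inj₁) ψ ≡ φ)

    omove : (C : Pos) → OMove C → Pos
    omove C m = record
      { New = New C ⊎ OMove.X m
      ; ΔC  = OMove.ΔC' m
      ; O   = λ φ → Image (O C) φ ⊎ OMove.A m φ
      ; P   = λ φ → Image (P C) φ
      }

    -- Opponent has a winning strategy from C (every play following it is
    -- finite and ends with Proponent having to move again after his own move).
    data OppWins (C : Pos) : Set₁ where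
      opp  : OppMustMove C → (m : OMove C)
           → PropMustMove (omove C m) → OppWins (omove C m) → OppWins C
      prop : PropMustMove C
           → ((m : PMove C) → PropMustMove (pmove C m) ⊎ OppWins (pmove C m))
           → OppWins C

module _ (S : Signature) where

  record KModel (K : Set) : Set₁ where
    field
      W      : Set
      _≤_    : W → W → Set
      isPO   : IsPartialOrder _≡_ _≤_
      U      : Set
      E      : W → U → Set             -- u ∈ Δ_w
      E-mono : ∀ {w v u} → w ≤ v → E w u → E v u
      cst    : K → U
      cst-E  : ∀ w k → E w (cst k)
      I      : (p : Pred S) → W → Vec U (ar S p) → Set
      I-E    : ∀ {p w us} → I p w us → All (E w) us
      I-mono : ∀ {p w v us} → w ≤ v → I p w us → I p v us

  module _ {K : Set} (M : KModel K) where
    open KModel M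

    Noetherian : Set
    Noetherian = ¬ (Σ (ℕ → W) λ f → ∀ n → (f n ≤ f (Data.Nat.suc n)) × (f n ≢ f (Data.Nat.suc n)))

    evalTm : (ℕ → Maybe U) → Tm K → Maybe U
    evalTm ρ (var x) = ρ x
    evalTm ρ (obj k) = just (cst k)

    Forces : W → (ℕ → Maybe U) → Fm S K → Set
    Forces w ρ (atom p ts) =
      Σ (Vec U (ar S p)) λ us → Pointwise (λ t u → evalTm ρ t ≡ just u) ts us × I p w us
    Forces w ρ ⊥' = ⊥
    Forces w ρ (A ⇒ B) = ∀ v → w ≤ v → Forces v ρ A → Forces v ρ B
    Forces w ρ (A ∧' B) = Forces w ρ A × Forces w ρ B
    Forces w ρ (A ∨' B) = Forces w ρ A ⊎ Forces w ρ B
    Forces w ρ (∀' x A) = ∀ v → w ≤ v → ∀ u → E v u → Forces v (_[_↦_] {X = U} ρ x u) A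
    Forces w ρ (∃' x A) = Σ U λ u → E w u × Forces w (_[_↦_] {X = U} ρ x u) A

{-# OPTIONS --safe #-}
module Submission where

-- Above ω choose, by Noetherianity and excluded middle, a maximal world w at which some
-- formula of P is not forced.  Opponent names every object of Δ_w and asserts every formula
-- of F(Γ,Δ) forced at w.  In the resulting position truth coincides with forcing at w on all
-- of F(Γ,Δ): at w by induction on the formula, and at strict successors of w because there,
-- by maximality, every formula of O ∪ P is forced.  So Opponent has no mistake while
-- Proponent keeps the one refuted at w.  After any move of Proponent, either the maximal
-- failing world is still w, and Proponent must move again, or it lies strictly above w; the
-- frame being Noetherian, the latter happens only finitely often.

open import Defs
open import Level using (0ℓ)
open import Axiom.ExcludedMiddle using (ExcludedMiddle)
open import Data.Nat using (ℕ; zero; suc; _≟_)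
open import Data.Maybe using (Maybe; just; nothing; maybe)
import Data.Maybe as Maybe
open import Data.Vec using (Vec; []; _∷_)
import Data.Vec as Vec
import Data.Vec.Properties as Vec
open import Data.Vec.Relation.Binary.Pointwise.Inductive as Pointwise using (Pointwise; []; _∷_)
open import Data.Product using (Σ; _×_; _,_; proj₁; proj₂)
open import Data.Product.Function.NonDependent.Propositional using (_×-⇔_)
open import Data.Sum using (_⊎_; inj₁; inj₂; [_,_])
import Data.Sum as Sum
open import Data.Sum.Function.Propositional using (_⊎-⇔_)
open import Data.Unit using (⊤; tt)
open import Data.Empty using (⊥)
open import Data.Bool using (true; false)
open import Function using (_∘_; id; flip)
open import Function.Bundles using (_⇔_; mk⇔; module Equivalence)
open import Function.Construct.Identity using (⇔-id)
open import Function.Construct.Composition using (_⇔-∘_)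
open import Function.Construct.Symmetry using (⇔-sym)
open import Function.Related.TypeIsomorphisms using (→-cong-⇔)
open import Induction.WellFounded using (WellFounded; Acc; acc)
open import Relation.Nullary using (¬_; does; yes; no)
open import Relation.Nullary.Decidable using (decidable-stable; dec-true; dec-false)
open import Relation.Binary.PropositionalEquality
  using (_≡_; _≢_; _≗_; refl; sym; trans; cong; cong₂; subst)
open import Relation.Binary.Structures using (IsPartialOrder)

open Equivalence using (to; from)

private variable
  A B X Y T : Set

∀-⇔ : {P Q : A → Set} → (∀ a → P a ⇔ Q a) → ((a : A) → P a) ⇔ ((a : A) → Q a)
∀-⇔ P⇔Q = mk⇔ (λ f a → to (P⇔Q a) (f a)) (λ g a → from (P⇔Q a) (g a))

∃-⇔ : {P Q : A → Set} → (∀ a → P a ⇔ Q a) → Σ A P ⇔ Σ A Q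
∃-⇔ P⇔Q = mk⇔ (λ (a , p) → a , to (P⇔Q a) p) (λ (a , q) → a , from (P⇔Q a) q)

subst-⇔ : (P : A → Set) {a b : A} → a ≡ b → P a ⇔ P b
subst-⇔ P a≡b = mk⇔ (subst P a≡b) (subst P (sym a≡b))

map-∘-cong : {f : B → X} {g : A → B} {h : A → X} → (∀ a → f (g a) ≡ h a)
           → ∀ {n} (as : Vec A n) → Vec.map f (Vec.map g as) ≡ Vec.map h as
map-∘-cong fg≗h as = trans (sym (Vec.map-∘ _ _ as)) (Vec.map-cong fg≗h as)

Env : Set → Set
Env X = ℕ → Maybe X

_⊕_ : Env X → Env X → Env X
(σ ⊕ ρ) y = maybe just (σ y) (ρ y)

↦-here : (ρ : Env X) (x : ℕ) (c : X) → (ρ [ x ↦ c ]) x ≡ just c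
↦-here ρ x c rewrite dec-true (x ≟ x) refl = refl

↦-there : (ρ : Env X) {x y : ℕ} (c : X) → y ≢ x → (ρ [ x ↦ c ]) y ≡ ρ y
↦-there ρ {x} {y} c y≢x rewrite dec-false (y ≟ x) y≢x = refl

∅-⊕ : (ρ : Env X) → ρ ≗ ∅ ⊕ ρ
∅-⊕ ρ y with ρ y
... | just c  = refl
... | nothing = refl

∖-⊕ : {τ σ ρ : Env X} (x : ℕ) → τ ≗ σ ⊕ ρ → τ ∖ x ≗ (σ ∖ x) ⊕ (ρ ∖ x)
∖-⊕ x τ≗σ⊕ρ y with does (y ≟ x)
... | true  = refl
... | false = τ≗σ⊕ρ y

↦-⊕ : {τ σ ρ ρ′ : Env X} (x : ℕ) (c : X) → τ ≗ σ ⊕ ρ → ρ ∖ x ≗ ρ′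
    → τ [ x ↦ c ] ≗ (σ [ x ↦ c ]) ⊕ ρ′
↦-⊕ x c τ≗σ⊕ρ ρ∖x≗ρ′ y rewrite sym (ρ∖x≗ρ′ y) with does (y ≟ x)
... | true  = refl
... | false = τ≗σ⊕ρ y

∖-map : (g : X → Y) {ρ : Env X} {ρ′ : Env Y} (x : ℕ)
      → ρ′ ≗ Maybe.map g ∘ ρ → ρ′ ∖ x ≗ Maybe.map g ∘ (ρ ∖ x)
∖-map g x ρ′≗gρ y with does (y ≟ x)
... | true  = refl
... | false = ρ′≗gρ y

↦-map : (g : X → Y) {ρ : Env X} {σ : Env Y} (x : ℕ) (c : X)
      → σ ≗ Maybe.map g ∘ ρ → σ [ x ↦ g c ] ≗ Maybe.map g ∘ (ρ [ x ↦ c ])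
↦-map g x c σ≗gρ y with does (y ≟ x)
... | true  = refl
... | false = σ≗gρ y

module _ {S : Signature} where

  subTm-sub : {τ σ ρ : Env T} → τ ≗ σ ⊕ ρ
            → (t : Tm T) → subTm {S} σ (subTm {S} ρ t) ≡ subTm {S} τ t
  subTm-sub {ρ = ρ} τ≗σ⊕ρ (var y) rewrite τ≗σ⊕ρ y with ρ y
  ... | just c  = refl
  ... | nothing = refl
  subTm-sub τ≗σ⊕ρ (obj a) = refl

  sub-sub : {τ σ ρ : Env T} → τ ≗ σ ⊕ ρ → (A : Fm S T) → sub σ (sub ρ A) ≡ sub τ A
  sub-sub e (atom p ts) = cong (atom p) (map-∘-cong (subTm-sub e) ts)
  sub-sub e ⊥'         = refl
  sub-sub e (A ⇒ B)    = cong₂ _⇒_ (sub-sub e A) (sub-sub e B)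
  sub-sub e (A ∧' B)   = cong₂ _∧'_ (sub-sub e A) (sub-sub e B)
  sub-sub e (A ∨' B)   = cong₂ _∨'_ (sub-sub e A) (sub-sub e B)
  sub-sub e (∀' x A)   = cong (∀' x) (sub-sub (∖-⊕ x e) A)
  sub-sub e (∃' x A)   = cong (∃' x) (sub-sub (∖-⊕ x e) A)

  mapTm-subTm : (g : A → B) {ρ : Env A} {ρ′ : Env B} → ρ′ ≗ Maybe.map g ∘ ρ
              → (t : Tm A) → mapTm {S} g (subTm {S} ρ t) ≡ subTm {S} ρ′ (mapTm {S} g t)
  mapTm-subTm g {ρ} ρ′≗gρ (var y) rewrite ρ′≗gρ y with ρ y
  ... | just c  = refl
  ... | nothing = refl
  mapTm-subTm g ρ′≗gρ (obj a) = refl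

  mapFm-sub : (g : A → B) {ρ : Env A} {ρ′ : Env B} → ρ′ ≗ Maybe.map g ∘ ρ
            → (F : Fm S A) → mapFm g (sub ρ F) ≡ sub ρ′ (mapFm g F)
  mapFm-sub g e (atom p ts) =
    cong (atom p) (trans (map-∘-cong (mapTm-subTm g e) ts) (sym (map-∘-cong (λ _ → refl) ts)))
  mapFm-sub g e ⊥'       = refl
  mapFm-sub g e (A ⇒ B)  = cong₂ _⇒_ (mapFm-sub g e A) (mapFm-sub g e B)
  mapFm-sub g e (A ∧' B) = cong₂ _∧'_ (mapFm-sub g e A) (mapFm-sub g e B)
  mapFm-sub g e (A ∨' B) = cong₂ _∨'_ (mapFm-sub g e A) (mapFm-sub g e B)
  mapFm-sub g e (∀' x A) = cong (∀' x) (mapFm-sub g (∖-map g x e) A)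
  mapFm-sub g e (∃' x A) = cong (∃' x) (mapFm-sub g (∖-map g x e) A)

  mapFm-∘ : (g : B → X) (f : A → B) (F : Fm S A) → mapFm g (mapFm f F) ≡ mapFm (g ∘ f) F
  mapFm-∘ g f (atom p ts) = cong (atom p) (map-∘-cong (λ { (var x) → refl ; (obj a) → refl }) ts)
  mapFm-∘ g f ⊥'       = refl
  mapFm-∘ g f (A ⇒ B)  = cong₂ _⇒_ (mapFm-∘ g f A) (mapFm-∘ g f B)
  mapFm-∘ g f (A ∧' B) = cong₂ _∧'_ (mapFm-∘ g f A) (mapFm-∘ g f B)
  mapFm-∘ g f (A ∨' B) = cong₂ _∨'_ (mapFm-∘ g f A) (mapFm-∘ g f B)
  mapFm-∘ g f (∀' x A) = cong (∀' x) (mapFm-∘ g f A)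
  mapFm-∘ g f (∃' x A) = cong (∃' x) (mapFm-∘ g f A)

  ≼-trans : {A B C : Fm S T} → A ≼ B → B ≼ C → A ≼ C
  ≼-trans p refl   = p
  ≼-trans p (⇒ˡ q) = ⇒ˡ (≼-trans p q)
  ≼-trans p (⇒ʳ q) = ⇒ʳ (≼-trans p q)
  ≼-trans p (∧ˡ q) = ∧ˡ (≼-trans p q)
  ≼-trans p (∧ʳ q) = ∧ʳ (≼-trans p q)
  ≼-trans p (∨ˡ q) = ∨ˡ (≼-trans p q)
  ≼-trans p (∨ʳ q) = ∨ʳ (≼-trans p q)
  ≼-trans p (∀' q) = ∀' (≼-trans p q)
  ≼-trans p (∃' q) = ∃' (≼-trans p q)

module _ {S : Signature} (C : Pos S) where

  InOP-sub : {τ σ ρ : Env (Const S ⊎ New C)} → τ ≗ σ ⊕ ρ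
           → (A : Fm S (Const S ⊎ New C)) → InOP S C (sub σ (sub ρ A)) ⇔ InOP S C (sub τ A)
  InOP-sub e A = subst-⇔ (InOP S C) (sub-sub e A)

  Tr-sub : {τ σ ρ : Env (Const S ⊎ New C)} → τ ≗ σ ⊕ ρ
         → (A : Fm S (Const S ⊎ New C)) → Tr S C σ (sub ρ A) ⇔ Tr S C τ A
  Tr-sub e (atom p ts) = subst-⇔ (O C) (sub-sub e (atom p ts))
  Tr-sub e ⊥'          = ⇔-id _
  Tr-sub e (A ⇒ B)     = InOP-sub e (A ⇒ B) ×-⇔ →-cong-⇔ (Tr-sub e A) (Tr-sub e B)
  Tr-sub e (A ∧' B)    = InOP-sub e (A ∧' B) ×-⇔ (Tr-sub e A ×-⇔ Tr-sub e B)
  Tr-sub e (A ∨' B)    = InOP-sub e (A ∨' B) ×-⇔ (Tr-sub e A ⊎-⇔ Tr-sub e B)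
  Tr-sub e (∀' x A)    = InOP-sub e (∀' x A) ×-⇔
    (∀-⇔ λ c → ∀-⇔ λ _ → Tr-sub (↦-⊕ x c e (λ _ → refl)) A)
  Tr-sub e (∃' x A)    = InOP-sub e (∃' x A) ×-⇔
    (∃-⇔ λ c → ⇔-id _ ×-⇔ Tr-sub (↦-⊕ x c e (λ _ → refl)) A)

  Holds-sub : (ρ : Env (Const S ⊎ New C)) (A : Fm S (Const S ⊎ New C))
            → Holds S C (sub ρ A) ⇔ Tr S C ρ A
  Holds-sub ρ = Tr-sub (∅-⊕ ρ)

module Semantics {S : Signature} {K : Set} (M : KModel S K) where
  open KModel M

  ≤-refl : ∀ {w} → w ≤ w
  ≤-refl = IsPartialOrder.refl isPO

  ≤-trans : ∀ {u v w} → u ≤ v → v ≤ w → u ≤ w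
  ≤-trans = IsPartialOrder.trans isPO

  Denotes : (A → Maybe U) → ∀ {n} → Vec A n → Vec U n → Set
  Denotes ev = Pointwise (λ a u → ev a ≡ just u)

  denotes-cong : {ev₁ ev₂ : A → Maybe U} → ev₁ ≗ ev₂
               → ∀ {n} {as : Vec A n} {us} → Denotes ev₁ as us ⇔ Denotes ev₂ as us
  denotes-cong e =
    mk⇔ (Pointwise.map (λ {a} → trans (sym (e a)))) (Pointwise.map (λ {a} → trans (e a)))

  denotes-map : {ev₁ : A → Maybe U} {ev₂ : B → Maybe U} (f : B → A) → (∀ b → ev₁ (f b) ≡ ev₂ b)
              → ∀ {n} (bs : Vec B n) {us} → Denotes ev₁ (Vec.map f bs) us ⇔ Denotes ev₂ bs us
  denotes-map {ev₁ = ev₁} {ev₂} f e bs = mk⇔ (forth bs) (back bs)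
    where
      forth : ∀ {n} (bs : Vec _ n) {us} → Denotes ev₁ (Vec.map f bs) us → Denotes ev₂ bs us
      forth []       []       = []
      forth (b ∷ bs) (r ∷ rs) = trans (sym (e b)) r ∷ forth bs rs
      back : ∀ {n} (bs : Vec _ n) {us} → Denotes ev₂ bs us → Denotes ev₁ (Vec.map f bs) us
      back []       []       = []
      back (b ∷ bs) (r ∷ rs) = trans (e b) r ∷ back bs rs

  evalT : (T → U) → Env U → Tm T → Maybe U
  evalT den σ (var x) = σ x
  evalT den σ (obj c) = just (den c)

  -- Forcing with the parameters interpreted by an arbitrary den rather than by cst: the objects
  -- Opponent introduces during the game are not constants of M.
  Forces⟨_⟩ : (T → U) → W → Env U → Fm S T → Set
  Forces⟨ den ⟩ w σ (atom p ts) = Σ (Vec U (ar S p)) λ us → Denotes (evalT den σ) ts us × I p w us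
  Forces⟨ den ⟩ w σ ⊥'         = ⊥
  Forces⟨ den ⟩ w σ (A ⇒ B)    = ∀ v → w ≤ v → Forces⟨ den ⟩ v σ A → Forces⟨ den ⟩ v σ B
  Forces⟨ den ⟩ w σ (A ∧' B)   = Forces⟨ den ⟩ w σ A × Forces⟨ den ⟩ w σ B
  Forces⟨ den ⟩ w σ (A ∨' B)   = Forces⟨ den ⟩ w σ A ⊎ Forces⟨ den ⟩ w σ B
  Forces⟨ den ⟩ w σ (∀' x A)   = ∀ v → w ≤ v → ∀ u → E v u → Forces⟨ den ⟩ v (σ [ x ↦ u ]) A
  Forces⟨ den ⟩ w σ (∃' x A)   = Σ U λ u → E w u × Forces⟨ den ⟩ w (σ [ x ↦ u ]) A

  forces⇔forces⟨cst⟩ : (A : Fm S K) → ∀ {w σ} → Forces S M w σ A ⇔ Forces⟨ cst ⟩ w σ A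
  forces⇔forces⟨cst⟩ (atom p ts) =
    ∃-⇔ λ _ → denotes-cong (λ { (var x) → refl ; (obj k) → refl }) ×-⇔ ⇔-id _
  forces⇔forces⟨cst⟩ ⊥'       = ⇔-id _
  forces⇔forces⟨cst⟩ (A ⇒ B)  =
    ∀-⇔ λ _ → ∀-⇔ λ _ → →-cong-⇔ (forces⇔forces⟨cst⟩ A) (forces⇔forces⟨cst⟩ B)
  forces⇔forces⟨cst⟩ (A ∧' B) = forces⇔forces⟨cst⟩ A ×-⇔ forces⇔forces⟨cst⟩ B
  forces⇔forces⟨cst⟩ (A ∨' B) = forces⇔forces⟨cst⟩ A ⊎-⇔ forces⇔forces⟨cst⟩ B
  forces⇔forces⟨cst⟩ (∀' x A) =
    ∀-⇔ λ _ → ∀-⇔ λ _ → ∀-⇔ λ _ → ∀-⇔ λ _ → forces⇔forces⟨cst⟩ A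
  forces⇔forces⟨cst⟩ (∃' x A) = ∃-⇔ λ _ → ⇔-id _ ×-⇔ forces⇔forces⟨cst⟩ A

  forces-mono : {den : T → U} {σ : Env U} (A : Fm S T) → ∀ {w v} → w ≤ v
              → Forces⟨ den ⟩ w σ A → Forces⟨ den ⟩ v σ A
  forces-mono (atom p ts) w≤v (us , d , i)  = us , d , I-mono w≤v i
  forces-mono (A ⇒ B)     w≤v f v′ v≤v′     = f v′ (≤-trans w≤v v≤v′)
  forces-mono (A ∧' B)    w≤v (a , b)       = forces-mono A w≤v a , forces-mono B w≤v b
  forces-mono (A ∨' B)    w≤v (inj₁ a)      = inj₁ (forces-mono A w≤v a)
  forces-mono (A ∨' B)    w≤v (inj₂ b)      = inj₂ (forces-mono B w≤v b)
  forces-mono (∀' x A)    w≤v f v′ v≤v′     = f v′ (≤-trans w≤v v≤v′)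
  forces-mono (∃' x A)    w≤v (u , u∈w , a) = u , E-mono w≤v u∈w , forces-mono A w≤v a

  evalT-subTm : {den : T → U} {τ σ : Env U} (ρ : Env T) → τ ≗ σ ⊕ (Maybe.map den ∘ ρ)
              → (t : Tm T) → evalT den σ (subTm {S} ρ t) ≡ evalT den τ t
  evalT-subTm ρ e (var y) rewrite e y with ρ y
  ... | just c  = refl
  ... | nothing = refl
  evalT-subTm ρ e (obj c) = refl

  forces-sub : {den : T → U} {τ σ : Env U} {ρ : Env T} → τ ≗ σ ⊕ (Maybe.map den ∘ ρ)
             → (A : Fm S T) → ∀ {w} → Forces⟨ den ⟩ w σ (sub ρ A) ⇔ Forces⟨ den ⟩ w τ A
  forces-sub {ρ = ρ} e (atom p ts) =
    ∃-⇔ λ _ → denotes-map (subTm {S} ρ) (evalT-subTm ρ e) ts ×-⇔ ⇔-id _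
  forces-sub e ⊥'       = ⇔-id _
  forces-sub e (A ⇒ B)  = ∀-⇔ λ _ → ∀-⇔ λ _ → →-cong-⇔ (forces-sub e A) (forces-sub e B)
  forces-sub e (A ∧' B) = forces-sub e A ×-⇔ forces-sub e B
  forces-sub e (A ∨' B) = forces-sub e A ⊎-⇔ forces-sub e B
  forces-sub {den = den} e (∀' x A) =
    ∀-⇔ λ _ → ∀-⇔ λ _ → ∀-⇔ λ u → ∀-⇔ λ _ →
      forces-sub (↦-⊕ x u e (∖-map den x λ _ → refl)) A
  forces-sub {den = den} e (∃' x A) =
    ∃-⇔ λ u → ⇔-id _ ×-⇔ forces-sub (↦-⊕ x u e (∖-map den x λ _ → refl)) A

  forces-instance : {den : T → U} {ρ : Env T} {σ : Env U} → σ ≗ Maybe.map den ∘ ρ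
                  → (A : Fm S T) → ∀ {w} → Forces⟨ den ⟩ w ∅ (sub ρ A) ⇔ Forces⟨ den ⟩ w σ A
  forces-instance {den = den} {ρ} σ≗ρ =
    forces-sub λ y → trans (σ≗ρ y) (∅-⊕ (Maybe.map den ∘ ρ) y)

  forces-mapFm : {den : A → U} {den′ : B → U} (g : A → B) → (∀ a → den′ (g a) ≡ den a)
               → (F : Fm S A) → ∀ {w σ} → Forces⟨ den′ ⟩ w σ (mapFm g F) ⇔ Forces⟨ den ⟩ w σ F
  forces-mapFm g e (atom p ts) =
    ∃-⇔ λ _ → denotes-map (mapTm {S} g) (λ { (var x) → refl ; (obj a) → cong just (e a) }) ts
              ×-⇔ ⇔-id _
  forces-mapFm g e ⊥'       = ⇔-id _
  forces-mapFm g e (A ⇒ B)  =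
    ∀-⇔ λ _ → ∀-⇔ λ _ → →-cong-⇔ (forces-mapFm g e A) (forces-mapFm g e B)
  forces-mapFm g e (A ∧' B) = forces-mapFm g e A ×-⇔ forces-mapFm g e B
  forces-mapFm g e (A ∨' B) = forces-mapFm g e A ⊎-⇔ forces-mapFm g e B
  forces-mapFm g e (∀' x A) =
    ∀-⇔ λ _ → ∀-⇔ λ _ → ∀-⇔ λ _ → ∀-⇔ λ _ → forces-mapFm g e A
  forces-mapFm g e (∃' x A) = ∃-⇔ λ _ → ⇔-id _ ×-⇔ forces-mapFm g e A

  _⊏_ : W → W → Set
  w ⊏ v = w ≤ v × w ≢ v

  Maximal : (W → Set) → W → Set
  Maximal Q w = Q w × (∀ {v} → w ⊏ v → ¬ Q v)

  module _ (em : ExcludedMiddle 0ℓ) where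

    noetherian⇒wellFounded : Noetherian S M → WellFounded (flip _⊏_)
    noetherian⇒wellFounded noetherian w = decidable-stable em λ ¬acc →
      noetherian (proj₁ ∘ chain (w , ¬acc) , λ n → proj₁ (proj₂ (climb (chain (w , ¬acc) n))))
      where
        Inaccessible : Set
        Inaccessible = Σ W λ v → ¬ Acc (flip _⊏_) v

        climb : ((v , _) : Inaccessible) → Σ W λ v′ → v ⊏ v′ × ¬ Acc (flip _⊏_) v′
        climb (v , ¬acc) = decidable-stable em λ ¬climb →
          ¬acc (acc λ {v′} v⊏v′ →
            decidable-stable em λ ¬acc′ → ¬climb (v′ , v⊏v′ , ¬acc′))

        chain : Inaccessible → ℕ → Inaccessible
        chain start zero    = start
        chain start (suc n) = proj₁ (climb (chain start n)) , proj₂ (proj₂ (climb (chain start n)))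

    maximal-above : WellFounded (flip _⊏_) → (Q : W → Set) → ∀ {w} → Q w
                  → Σ W λ v → w ≤ v × Maximal Q v
    maximal-above wf Q {w} = go (wf w)
      where
        go : ∀ {w} → Acc (flip _⊏_) w → Q w → Σ W λ v → w ≤ v × Maximal Q v
        go {w} (acc rs) q with em {Σ W λ v → w ⊏ v × Q v}
        ... | yes (v , w⊏v , qᵥ) = let (u , v≤u , max) = go (rs w⊏v) qᵥ in
                                   u , ≤-trans (proj₁ w⊏v) v≤u , max
        ... | no ¬higher         = w , ≤-refl , q , λ w⊏v qᵥ → ¬higher (_ , w⊏v , qᵥ)

module Strategy {S : Signature} {K : Set} (M : KModel S K) (em : ExcludedMiddle 0ℓ)
                (Γ : Fm S (Const S) → Set) where
  open KModel M
  open Semantics M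

  Par : Pos S → Set
  Par D = Const S ⊎ New D

  Δ : (D : Pos S) → Par D → Set
  Δ D = InΔ S (New D) (ΔC D)

  𝓕 : (D : Pos S) → Fm S (Par D) → Set
  𝓕 D = InF S Γ (New D) (ΔC D)

  module _ (D : Pos S) (den : Par D → U) where

    Fails : W → Set
    Fails v = Σ (Fm S (Par D)) λ φ → P D φ × ¬ Forces⟨ den ⟩ v ∅ φ

    record Sound (w : W) : Set where
      field
        O-forced   : ∀ φ → O D φ → Forces⟨ den ⟩ w ∅ φ
        den-exists : ∀ c → E w (den c)

    record Mirrors (w : W) : Set where
      field
        sound      : Sound w
        O-complete : ∀ φ → 𝓕 D φ → Forces⟨ den ⟩ w ∅ φ → O D φ
        den-onto   : ∀ u → E w u → Σ (Par D) λ c → Δ D c × den c ≡ u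

  sound-mono : ∀ {D den w v} → w ≤ v → Sound D den w → Sound D den v
  sound-mono w≤v sound = record
    { O-forced   = λ φ o → forces-mono φ w≤v (O-forced φ o)
    ; den-exists = λ c → E-mono w≤v (den-exists c)
    } where open Sound sound

  module _ {D : Pos S} (m : PMove S Γ D) where

    pmove-isPosition : IsPosition S Γ D → IsPosition S Γ (pmove S Γ D m)
    pmove-isPosition (O⊆F , P⊆F) = O⊆F , λ φ → [ P⊆F φ , PMove.A⊆F m φ ]

    pmove-fails : ∀ {den v} → Fails D den v → Fails (pmove S Γ D m) den v
    pmove-fails (φ , p , ¬forced) = φ , inj₁ p , ¬forced

    pmove-sound : ∀ {den w} → Sound D den w → Sound (pmove S Γ D m) den w
    pmove-sound sound = record { O-forced = O-forced ; den-exists = den-exists }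
      where open Sound sound

    pmove-mirrors : ∀ {den w} → Mirrors D den w → Mirrors (pmove S Γ D m) den w
    pmove-mirrors mirrors = record
      { sound = pmove-sound sound ; O-complete = O-complete ; den-onto = den-onto }
      where open Mirrors mirrors

  module TruthLemma {D : Pos S} (isPos : IsPosition S Γ D) {den : Par D → U} {w : W}
                    (mirrors : Mirrors D den w) (maximal : Maximal (Fails D den) w) where
    open Mirrors mirrors
    open Sound sound

    P-forced-above : ∀ {v} → w ⊏ v → ∀ φ → P D φ → Forces⟨ den ⟩ v ∅ φ
    P-forced-above w⊏v φ p = decidable-stable em λ ¬forced → proj₂ maximal w⊏v (φ , p , ¬forced)

    instance-forced-above : ∀ {v} → w ⊏ v → {ρ : Env (Par D)} {σ : Env U} → σ ≗ Maybe.map den ∘ ρ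
                          → (A : Fm S (Par D)) → InOP S D (sub ρ A) → Forces⟨ den ⟩ v σ A
    instance-forced-above w⊏v σ≗ρ A (inj₁ o) =
      to (forces-instance σ≗ρ A) (forces-mono (sub _ A) (proj₁ w⊏v) (O-forced _ o))
    instance-forced-above w⊏v σ≗ρ A (inj₂ p) =
      to (forces-instance σ≗ρ A) (P-forced-above w⊏v _ p)

    Covers : Fm S (Const S) → Env (Par D) → Set
    Covers ψ ρ = ∀ x → FreeIn x ψ → Σ (Par D) λ c → ρ x ≡ just c × Δ D c

    covers-↦ : {ρ : Env (Par D)} {x : ℕ} {A Q : Fm S (Const S)} {c : Par D}
             → (∀ {y} → y ≢ x → FreeIn y A → FreeIn y Q) → Covers Q ρ → Δ D c
             → Covers A (ρ [ x ↦ c ])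
    covers-↦ {ρ} {x} {c = c} bound cov c∈Δ y y∈A with y ≟ x
    ... | yes refl = c , ↦-here ρ y c , c∈Δ
    ... | no y≢x   = let (c′ , ρy≡c′ , c′∈Δ) = cov y (bound y≢x y∈A) in
                     c′ , trans (↦-there ρ c y≢x) ρy≡c′ , c′∈Δ

    Agrees : Env U → Env (Par D) → Fm S (Const S) → Set
    Agrees σ ρ ψ = Forces⟨ den ⟩ w σ (mapFm inj₁ ψ) ⇔ Tr S D ρ (mapFm inj₁ ψ)

    forced⇒O : ∀ {γ} → Γ γ → (ψ : Fm S (Const S)) → ψ ≼ γ → {ρ : Env (Par D)} → Covers ψ ρ
             → {σ : Env U} → σ ≗ Maybe.map den ∘ ρ
             → Forces⟨ den ⟩ w σ (mapFm inj₁ ψ) → O D (sub ρ (mapFm inj₁ ψ))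
    forced⇒O γ∈Γ ψ ψ≼γ cov σ≗ρ f =
      O-complete _ (_ , γ∈Γ , ψ , ψ≼γ , _ , cov , refl) (from (forces-instance σ≗ρ (mapFm inj₁ ψ)) f)

    recorded-⇔ : {F R : Set} {φ : Fm S (Par D)} → (F → O D φ) → F ⇔ R → F ⇔ (InOP S D φ × R)
    recorded-⇔ F⇒O F⇔R = mk⇔ (λ f → inj₁ (F⇒O f) , to F⇔R f) (from F⇔R ∘ proj₂)

    truth : ∀ {γ} → Γ γ → (ψ : Fm S (Const S)) → ψ ≼ γ → {ρ : Env (Par D)} → Covers ψ ρ
          → {σ : Env U} → σ ≗ Maybe.map den ∘ ρ → Agrees σ ρ ψ
    truth γ∈Γ (atom p ts) ψ≼γ {ρ} cov σ≗ρ =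
      mk⇔ (forced⇒O γ∈Γ (atom p ts) ψ≼γ cov σ≗ρ)
          (to (forces-instance {ρ = ρ} σ≗ρ (mapFm inj₁ (atom p ts))) ∘ O-forced _)
    truth γ∈Γ ⊥' ψ≼γ cov σ≗ρ = ⇔-id _
    truth γ∈Γ (A ⇒ B) ψ≼γ {ρ} cov {σ} σ≗ρ = mk⇔
      (λ f → inj₁ (forced⇒O γ∈Γ (A ⇒ B) ψ≼γ cov σ≗ρ f) ,
             λ a → to IHB (f w ≤-refl (from IHA a)))
      (λ (i , g) v w≤v → forced v w≤v i g)
      where
        IHA : Agrees σ ρ A
        IHA = truth γ∈Γ A (≼-trans (⇒ˡ refl) ψ≼γ) (λ x → cov x ∘ ⇒ˡ) σ≗ρ
        IHB : Agrees σ ρ B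
        IHB = truth γ∈Γ B (≼-trans (⇒ʳ refl) ψ≼γ) (λ x → cov x ∘ ⇒ʳ) σ≗ρ
        forced : ∀ v → w ≤ v → InOP S D (sub ρ (mapFm inj₁ (A ⇒ B)))
               → (Tr S D ρ (mapFm inj₁ A) → Tr S D ρ (mapFm inj₁ B))
               → Forces⟨ den ⟩ v σ (mapFm inj₁ A) → Forces⟨ den ⟩ v σ (mapFm inj₁ B)
        forced v w≤v i g with em {w ≡ v}
        ... | yes refl = from IHB ∘ g ∘ to IHA
        ... | no w≢v   = instance-forced-above (w≤v , w≢v) σ≗ρ (mapFm inj₁ (A ⇒ B)) i v ≤-refl
    truth γ∈Γ (A ∧' B) ψ≼γ cov σ≗ρ = recorded-⇔ (forced⇒O γ∈Γ (A ∧' B) ψ≼γ cov σ≗ρ)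
      (truth γ∈Γ A (≼-trans (∧ˡ refl) ψ≼γ) (λ x → cov x ∘ ∧ˡ) σ≗ρ ×-⇔
       truth γ∈Γ B (≼-trans (∧ʳ refl) ψ≼γ) (λ x → cov x ∘ ∧ʳ) σ≗ρ)
    truth γ∈Γ (A ∨' B) ψ≼γ cov σ≗ρ = recorded-⇔ (forced⇒O γ∈Γ (A ∨' B) ψ≼γ cov σ≗ρ)
      (truth γ∈Γ A (≼-trans (∨ˡ refl) ψ≼γ) (λ x → cov x ∘ ∨ˡ) σ≗ρ ⊎-⇔
       truth γ∈Γ B (≼-trans (∨ʳ refl) ψ≼γ) (λ x → cov x ∘ ∨ʳ) σ≗ρ)
    truth γ∈Γ (∀' x A) ψ≼γ {ρ} cov {σ} σ≗ρ = mk⇔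
      (λ f → inj₁ (forced⇒O γ∈Γ (∀' x A) ψ≼γ cov σ≗ρ f) ,
             λ c c∈Δ → to (IH c∈Δ) (f w ≤-refl (den c) (den-exists c)))
      (λ (i , g) v w≤v → forced v w≤v i g)
      where
        IH : ∀ {c} → Δ D c → Agrees (σ [ x ↦ den c ]) (ρ [ x ↦ c ]) A
        IH {c} c∈Δ =
          truth γ∈Γ A (≼-trans (∀' refl) ψ≼γ) (covers-↦ {ρ} {x} ∀' cov c∈Δ) (↦-map den x c σ≗ρ)
        forced : ∀ v → w ≤ v → InOP S D (sub ρ (mapFm inj₁ (∀' x A)))
               → (∀ c → Δ D c → Tr S D (ρ [ x ↦ c ]) (mapFm inj₁ A))
               → ∀ u → E v u → Forces⟨ den ⟩ v (σ [ x ↦ u ]) (mapFm inj₁ A)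
        forced v w≤v i g u u∈v with em {w ≡ v}
        ... | yes refl = let (c , c∈Δ , c↦u) = den-onto u u∈v in
          subst (λ u → Forces⟨ den ⟩ w (σ [ x ↦ u ]) (mapFm inj₁ A)) c↦u (from (IH c∈Δ) (g c c∈Δ))
        ... | no w≢v   =
          instance-forced-above (w≤v , w≢v) σ≗ρ (mapFm inj₁ (∀' x A)) i v ≤-refl u u∈v
    truth γ∈Γ (∃' x A) ψ≼γ {ρ} cov {σ} σ≗ρ = mk⇔
      (λ f@(u , u∈w , a) → inj₁ (forced⇒O γ∈Γ (∃' x A) ψ≼γ cov σ≗ρ f) ,
        let (c , c∈Δ , c↦u) = den-onto u u∈w in
        c , c∈Δ , to (IH c∈Δ) (subst (λ u → Forces⟨ den ⟩ w (σ [ x ↦ u ]) (mapFm inj₁ A))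
                                     (sym c↦u) a))
      (λ (_ , c , c∈Δ , t) → den c , den-exists c , from (IH c∈Δ) t)
      where
        IH : ∀ {c} → Δ D c → Agrees (σ [ x ↦ den c ]) (ρ [ x ↦ c ]) A
        IH {c} c∈Δ =
          truth γ∈Γ A (≼-trans (∃' refl) ψ≼γ) (covers-↦ {ρ} {x} ∃' cov c∈Δ) (↦-map den x c σ≗ρ)

    holds⇔forces : ∀ φ → 𝓕 D φ → Holds S D φ ⇔ Forces⟨ den ⟩ w ∅ φ
    holds⇔forces _ (γ , γ∈Γ , ψ , ψ≼γ , ρ , cov , refl) =
      ⇔-sym (forces-instance (λ _ → refl) (mapFm inj₁ ψ))
        ⇔-∘ (⇔-sym (truth γ∈Γ ψ ψ≼γ cov (λ _ → refl)) ⇔-∘ Holds-sub D ρ (mapFm inj₁ ψ))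

    propMustMove : PropMustMove S D
    propMustMove = no-opp-mistake , prop-mistake
      where
        no-opp-mistake : ¬ OppMistake S D
        no-opp-mistake (φ , o , ¬holds) =
          ¬holds (from (holds⇔forces φ (proj₁ isPos φ o)) (O-forced φ o))
        prop-mistake : PropMistake S D
        prop-mistake = let (φ , p , ¬forced) = proj₁ maximal in
          φ , p , ¬forced ∘ to (holds⇔forces φ (proj₂ isPos φ p))

  module OpponentMove {D : Pos S} (isPos : IsPosition S Γ D) {den : Par D → U} {w : W}
                      (sound : Sound D den w) where
    open Sound sound

    Objects : Set
    Objects = Σ U (E w)

    den′ : Const S ⊎ (New D ⊎ Objects) → U
    den′ (inj₁ k)              = den (inj₁ k)
    den′ (inj₂ (inj₁ n))       = den (inj₂ n)
    den′ (inj₂ (inj₂ (u , _))) = u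

    lift : Par D → Const S ⊎ (New D ⊎ Objects)
    lift = Sum.map₂ inj₁

    den′-lift : ∀ a → den′ (lift a) ≡ den a
    den′-lift (inj₁ k) = refl
    den′-lift (inj₂ n) = refl

    allConstants : Const S → Set
    allConstants _ = ⊤

    move : OMove S Γ D
    move = record
      { X   = Objects
      ; ΔC' = allConstants
      ; ext = _
      ; A   = λ φ → InF S Γ (New D ⊎ Objects) allConstants φ × Forces⟨ den′ ⟩ w ∅ φ
      ; A⊆F = λ _ → proj₁
      }

    D′ : Pos S
    D′ = omove S Γ D move

    𝓕-lift : ∀ {φ} → 𝓕 D φ → 𝓕 D′ (mapFm lift φ)
    𝓕-lift (γ , γ∈Γ , ψ , ψ≼γ , ρ , cov , refl) =
      γ , γ∈Γ , ψ , ψ≼γ , Maybe.map lift ∘ ρ ,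
      (λ x x∈ψ → let (c , ρx≡c , _) = cov x x∈ψ in lift c , cong (Maybe.map lift) ρx≡c , lift∈Δ c) ,
      trans (mapFm-sub lift (λ _ → refl) (mapFm inj₁ ψ)) (cong (sub _) (mapFm-∘ lift inj₁ ψ))
      where
        lift∈Δ : ∀ c → Δ D′ (lift c)
        lift∈Δ (inj₁ k) = tt
        lift∈Δ (inj₂ n) = tt

    isPosition : IsPosition S Γ D′
    isPosition =
      (λ { _ (inj₁ (ψ , o , refl)) → 𝓕-lift (proj₁ isPos ψ o) ; _ (inj₂ (φ∈𝓕 , _)) → φ∈𝓕 }) ,
      (λ { _ (ψ , p , refl) → 𝓕-lift (proj₂ isPos ψ p) })

    mirrors : Mirrors D′ den′ w
    mirrors = record
      { sound = record
        { O-forced   = λ { _ (inj₁ (ψ , o , refl)) → from (forces-mapFm lift den′-lift ψ) (O-forced ψ o)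
                         ; _ (inj₂ (_ , forced)) → forced }
        ; den-exists = λ { (inj₁ k) → den-exists (inj₁ k)
                         ; (inj₂ (inj₁ n)) → den-exists (inj₂ n)
                         ; (inj₂ (inj₂ (_ , u∈w))) → u∈w }
        }
      ; O-complete = λ φ φ∈𝓕 forced → inj₂ (φ∈𝓕 , forced)
      ; den-onto   = λ u u∈w → inj₂ (inj₂ (u , u∈w)) , tt , refl
      }

    maximal′ : Maximal (Fails D den) w → Maximal (Fails D′ den′) w
    maximal′ ((ψ , p , ¬forced) , none-above) =
      (mapFm lift ψ , (ψ , p , refl) , ¬forced ∘ to (forces-mapFm lift den′-lift ψ)) ,
      λ { w⊏v (_ , (ψ′ , p′ , refl) , ¬forced′) →
            none-above w⊏v (ψ′ , p′ , ¬forced′ ∘ from (forces-mapFm lift den′-lift ψ′)) }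

  module _ (wf : WellFounded (flip _⊏_)) where

    propMustMove⊎oppWins-maximal : ∀ {w} → Acc (flip _⊏_) w → (D : Pos S) → IsPosition S Γ D
      → (den : Par D → U) → Sound D den w → Maximal (Fails D den) w
      → PropMustMove S D ⊎ OppWins S Γ D
    propMustMove⊎oppWins-maximal {w} (acc rs) D isPos den sound maximal with em {PropMustMove S D}
    ... | yes propMustMove = inj₁ propMustMove
    ... | no oppMustMove   = inj₂ (opp oppMustMove move propMustMove′ (prop propMustMove′ respond))
      where
        open OpponentMove isPos sound

        propMustMove′ : PropMustMove S D′
        propMustMove′ = TruthLemma.propMustMove isPosition mirrors (maximal′ maximal)

        respond : (m : PMove S Γ D′)
                → PropMustMove S (pmove S Γ D′ m) ⊎ OppWins S Γ (pmove S Γ D′ m)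
        respond m with maximal-above em wf (Fails (pmove S Γ D′ m) den′)
                                        (pmove-fails m (proj₁ (maximal′ maximal)))
        ... | v , w≤v , maximal″ with em {w ≡ v}
        ... | yes refl = inj₁ (TruthLemma.propMustMove (pmove-isPosition m isPosition)
                                                       (pmove-mirrors m mirrors) maximal″)
        ... | no w≢v   = propMustMove⊎oppWins-maximal (rs (w≤v , w≢v)) (pmove S Γ D′ m)
                           (pmove-isPosition m isPosition) den′
                           (sound-mono w≤v (pmove-sound m (Mirrors.sound mirrors))) maximal″

    propMustMove⊎oppWins : ∀ {w} (D : Pos S) → IsPosition S Γ D → (den : Par D → U)
                         → Sound D den w → Fails D den w → PropMustMove S D ⊎ OppWins S Γ D
    propMustMove⊎oppWins D isPos den sound fails =
      let (v , w≤v , maximal) = maximal-above em wf (Fails D den) fails in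
      propMustMove⊎oppWins-maximal (wf v) D isPos den (sound-mono w≤v sound) maximal

proposition1 : (S : Signature)
    → (∀ {ℓ} → ExcludedMiddle ℓ)
    → (O₀ : Fm S (Const S) → Set) (φ : Fm S (Const S))
    → (∀ ψ → O₀ ψ → Closed ψ) → Closed φ
    → (C : Pos S) → IsPosition S (Γof S O₀ φ) C
    → (M : KModel S (Const S ⊎ New C)) → Noetherian S M
    → (ω : KModel.W M)
    → (∀ ψ → O C ψ → Forces S M ω ∅ ψ)
    → Σ (Fm S (Const S ⊎ New C)) (λ ψ → P C ψ × ¬ Forces S M ω ∅ ψ)
    → OppWins S (Γof S O₀ φ) C
proposition1 S em O₀ φ _ _ C isPos M noetherian ω O-forced (ψ , p , ¬forced) =
  [ (λ propMustMove → prop propMustMove λ m →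
       propMustMove⊎oppWins wf (pmove S Γ C m) (pmove-isPosition m isPos) cst
                            (pmove-sound m sound) (pmove-fails m fails))
  , id
  ] (propMustMove⊎oppWins wf C isPos cst sound fails)
  where
    Γ : Fm S (Const S) → Set
    Γ = Γof S O₀ φ

    open KModel M
    open Semantics M
    open Strategy M em Γ

    wf : WellFounded (flip _⊏_)
    wf = noetherian⇒wellFounded em noetherian

    sound : Sound C cst ω
    sound = record
      { O-forced   = λ χ o → to (forces⇔forces⟨cst⟩ χ) (O-forced χ o)
      ; den-exists = cst-E ω
      }

    fails : Fails C cst ω
    fails = ψ , p , ¬forced ∘ from (forces⇔forces⟨cst⟩ ψ)
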